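{- Let $f\colon\{0,1\}^n\to\{0,1\}$ be a Boolean function and let $\mathbf{p}$ be a $q$-fixing random projection from $x_1,\dots,x_n$ to $y_1,\dots,y_m$. Then \[\Pr[L(f|_{\mathbf{p}})=1]\le q\cdot\sqrt{L(f)}.\]
   Context: $L(f)$ is the minimal number of leaves of a De Morgan formula (binary tree, leaves labeled by literals, internal nodes AND/OR) computing $f$; $L$ of a constant is $0$. A projection $\pi$ from $x_1,\dots,x_n$ to $y_1,\dots,y_m$ is a map $\{x_1,\dots,x_n\}\to\{0,1,y_1,\overline{y_1},\dots,y_m,\overline{y_m}\}$, and $f|_\pi$ is the function of $y_1,\dots,y_m$ obtained by substituting $\pi(x_i)$ for $x_i$. A random projection is a distribution over projections. $\pi_{y_j\gets\sigma}$ denotes $\pi$ with $y_j$ substituted by $\sigma\in\{0,1\}$, and $\mathrm{var}(\ell)$ is the variable underlying a literal $\ell$. A random projection $\mathbf{p}$ is $(q_0,q_1)$-fixing if for all projections $\pi$, $\sigma\in\{0,1\}$ and variables $x_i$: $\Pr[\mathbf{p}(x_i)\notin\{0,1\}\text{ and }\mathbf{p}_{\mathrm{var}(\mathbf{p}(x_i))\gets\sigma}=\pi]\le q_\sigma\Pr[\mathbf{p}=\pi]$; it is $q$-fixing if it is $(q_0,q_1)$-fixing with $q=\sqrt{q_0q_1}$. -}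

module Defs where

open import Level using (0ℓ)
open import Data.Bool using (Bool; true; false; not; _∧_; _∨_; if_then_else_)
open import Data.Nat as ℕ using (ℕ; zero; suc)
open import Data.Fin using (Fin; zero; suc)
open import Data.Fin.Properties using (all?)
open import Data.Fin.Properties using () renaming (_≟_ to _≟F_)
open import Data.Bool.Properties using () renaming (_≟_ to _≟B_)
open import Data.Product using (Σ; _×_; _,_)
open import Data.Sum using (_⊎_)
open import Relation.Nullary using (¬_; Dec; yes; no; does)
open import Relation.Binary.PropositionalEquality using (_≡_; refl)
open import Relation.Binary.Structures using (IsTotalOrder)
open import Algebra.Structures using (IsCommutativeRing)

-- Scalars: an arbitrary (totally) ordered commutative ring
-- (the real numbers are an instance; probabilities live here)

record OrderedCommRing : Set₁ where
  infixl 6 _+_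
  infixl 7 _*_
  infix 4 _≤_
  field
    Carrier : Set
    _+_ _*_ : Carrier → Carrier → Carrier
    -_ : Carrier → Carrier
    0# 1# : Carrier
    _≤_ : Carrier → Carrier → Set
    isCommutativeRing : IsCommutativeRing _≡_ _+_ _*_ -_ 0# 1#
    isTotalOrder : IsTotalOrder _≡_ _≤_
    +-monoʳ-≤ : ∀ {a b} c → a ≤ b → c + a ≤ c + b
    *-nonneg : ∀ {a b} → 0# ≤ a → 0# ≤ b → 0# ≤ a * b

module _ (R : OrderedCommRing) where
  open OrderedCommRing R

  fromℕ : ℕ → Carrier
  fromℕ zero = 0#
  fromℕ (suc k) = 1# + fromℕ k

  sumFin : ∀ {N} → (Fin N → Carrier) → Carrier
  sumFin {zero} g = 0#
  sumFin {suc N} g = g zero + sumFin (λ i → g (suc i))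

BoolFun : ℕ → Set
BoolFun n = (Fin n → Bool) → Bool

data Lit (m : ℕ) : Set where
  pos : Fin m → Lit m
  neg : Fin m → Lit m

var : ∀ {m} → Lit m → Fin m
var (pos j) = j
var (neg j) = j

evalLit : ∀ {m} → Lit m → (Fin m → Bool) → Bool
evalLit (pos j) y = y j
evalLit (neg j) y = not (y j)

data Formula (n : ℕ) : Set where
  leaf : Lit n → Formula n
  and  : Formula n → Formula n → Formula n
  or   : Formula n → Formula n → Formula n

evalF : ∀ {n} → Formula n → (Fin n → Bool) → Bool
evalF (leaf ℓ) x = evalLit ℓ x
evalF (and F G) x = evalF F x ∧ evalF G x
evalF (or F G) x = evalF F x ∨ evalF G x

leaves : ∀ {n} → Formula n → ℕ
leaves (leaf _) = 1
leaves (and F G) = leaves F ℕ.+ leaves G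
leaves (or F G) = leaves F ℕ.+ leaves G

Computes : ∀ {n} → Formula n → BoolFun n → Set
Computes F g = ∀ x → evalF F x ≡ g x

Constant : ∀ {n} → BoolFun n → Set
Constant g = Σ Bool λ b → ∀ x → g x ≡ b

HasL : ∀ {n} → BoolFun n → ℕ → Set
HasL g k =
  (Constant g × k ≡ 0)
  ⊎ (¬ Constant g
     × Σ (Formula _) (λ F → Computes F g × leaves F ≡ k)
     × (∀ F → Computes F g → k ℕ.≤ leaves F))

data Target (m : ℕ) : Set where
  const : Bool → Target m
  lit   : Lit m → Target m

Projection : ℕ → ℕ → Set
Projection n m = Fin n → Target m

evalT : ∀ {m} → Target m → (Fin m → Bool) → Bool
evalT (const b) y = b
evalT (lit ℓ) y = evalLit ℓ y

restrict : ∀ {n m} → BoolFun n → Projection n m → BoolFun m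
restrict f π y = f (λ i → evalT (π i) y)

substT : ∀ {m} → Target m → Fin m → Bool → Target m
substT (const b) j σ = const b
substT (lit (pos k)) j σ = if does (k ≟F j) then const σ else lit (pos k)
substT (lit (neg k)) j σ = if does (k ≟F j) then const (not σ) else lit (neg k)

substP : ∀ {n m} → Projection n m → Fin m → Bool → Projection n m
substP π j σ i = substT (π i) j σ

_≟L_ : ∀ {m} (a b : Lit m) → Dec (a ≡ b)
pos j ≟L pos k with j ≟F k
... | yes refl = yes refl
... | no ne = no λ { refl → ne refl }
neg j ≟L neg k with j ≟F k
... | yes refl = yes refl
... | no ne = no λ { refl → ne refl }
pos j ≟L neg k = no λ ()
neg j ≟L pos k = no λ ()

_≟T_ : ∀ {m} (a b : Target m) → Dec (a ≡ b)
const a ≟T const b with a ≟B b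
... | yes refl = yes refl
... | no ne = no λ { refl → ne refl }
lit a ≟T lit b with a ≟L b
... | yes refl = yes refl
... | no ne = no λ { refl → ne refl }
const _ ≟T lit _ = no λ ()
lit _ ≟T const _ = no λ ()

_==P_ : ∀ {n m} → Projection n m → Projection n m → Bool
π ==P ρ = does (all? (λ i → π i ≟T ρ i))

-- Random projections: finite probability space Ω = Fin N with weights

record RandomProjection (R : OrderedCommRing) (n m : ℕ) : Set where
  open OrderedCommRing R
  field
    N      : ℕ
    proj   : Fin N → Projection n m
    weight : Fin N → Carrier
    weight-nonneg : ∀ ω → 0# ≤ weight ω
    weight-sum    : sumFin R weight ≡ 1#

module _ {R : OrderedCommRing} {n m : ℕ} (p : RandomProjection R n m) where
  open OrderedCommRing R
  open RandomProjection p

  Pr : (Fin N → Bool) → Carrier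
  Pr E = sumFin R (λ ω → if E ω then weight ω else 0#)

  ev-eq : Projection n m → Fin N → Bool
  ev-eq π ω = proj ω ==P π

  ev-fix : Fin n → Bool → Projection n m → Fin N → Bool
  ev-fix i σ π ω with proj ω i
  ... | const _ = false
  ... | lit ℓ = substP (proj ω) (var ℓ) σ ==P π

  Fixing : Carrier → Carrier → Set
  Fixing q₀ q₁ = ∀ (π : Projection n m) (σ : Bool) (i : Fin n) →
    Pr (ev-fix i σ π) ≤ (if σ then q₁ else q₀) * Pr (ev-eq π)

-- Use a minimal formula F for f as a Karchmer–Wigderson protocol. For a sample point ω with
-- L(f|_p) = 1, f|_p is a literal on some y_j, and setting y_j to its two values gives projections
-- on which F is 0 and 1. Walking down F, keeping a rectangle Z × O of 0- and 1-projections that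
-- contains this pair, ends at a leaf x_i with p(x_i) a literal on y_j. Charging ω to that leaf
-- splits Pr[S] into L(f) shares e; the fixing property, summed over the values of p, gives
-- e² ≤ 4 q₀q₁ Pr[p ∈ Z] Pr[p ∈ O] for the leaf's rectangle. The rectangles of the leaves
-- partition the 0- and 1-projections of F, so Σ e² ≤ 4 q₀q₁ Pr[F = 0] Pr[F = 1] ≤ q₀q₁, and
-- Cauchy–Schwarz yields Pr[S]² ≤ L(f) Σ e² ≤ q₀q₁ L(f).

module Submission where

open import Defs
open import Level using (0ℓ)
open import Algebra.Bundles using (CommutativeRing)
open import Data.Bool using (Bool; true; false; not; _∧_; _∨_; if_then_else_)
open import Data.Bool.ListAction using (any)
open import Data.Bool.Properties using (∧-zeroʳ; ∧-identityʳ; ∨-zeroʳ; T-≡; not-involutive)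
open import Data.Empty using (⊥-elim)
open import Data.Fin using (Fin; zero; suc)
open import Data.Fin.Properties using (all?) renaming (_≟_ to _≟F_)
open import Data.List using (List; []; _∷_; _++_; map; length; foldr)
open import Data.List.Properties using (map-++; map-cong-local; length-++)
open import Data.List.Relation.Unary.All as All using (All; []; _∷_)
open import Data.List.Relation.Unary.AllPairs using (AllPairs; []; _∷_)
open import Data.Nat as ℕ using (ℕ; zero; suc)
import Data.Nat.Properties as ℕP
open import Data.Product using (Σ; _×_; _,_; proj₁; proj₂)
open import Data.Sum using (_⊎_; inj₁; inj₂)
open import Function using (_∘_)
open import Function.Bundles using (Equivalence)
open import Relation.Binary.Bundles using (Poset)
open import Relation.Binary.Structures using (IsTotalOrder)
open import Relation.Binary.PropositionalEquality
  using (_≡_; _≢_; _≗_; refl; sym; trans; cong; cong₂; subst; subst₂)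
open import Relation.Nullary using (¬_; yes; no; does)
open import Relation.Nullary.Decidable using (dec-true; toWitness; isYes≗does)

∧-≡-true : ∀ a {b} → a ∧ b ≡ true → a ≡ true × b ≡ true
∧-≡-true true b≡true = refl , b≡true

∧-≡-false : ∀ {a b} → a ≡ true → a ∧ b ≡ false → b ≡ false
∧-≡-false refl b≡false = b≡false

∨-≡-false : ∀ a {b} → a ∨ b ≡ false → a ≡ false × b ≡ false
∨-≡-false false b≡false = refl , b≡false

∨-≡-true : ∀ {a b} → a ≡ false → a ∨ b ≡ true → b ≡ true
∨-≡-true refl b≡true = b≡true

not-≡-true : ∀ {a} → not a ≡ true → a ≡ false
not-≡-true {false} _ = refl

Σ-Bool⇒⊎ : ∀ {P : Bool → Set} → Σ Bool P → P true ⊎ P false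
Σ-Bool⇒⊎ (true  , p) = inj₁ p
Σ-Bool⇒⊎ (false , p) = inj₂ p

module OrderedCommRingProperties (R : OrderedCommRing) where
  open OrderedCommRing R

  commutativeRing : CommutativeRing 0ℓ 0ℓ
  commutativeRing = record { isCommutativeRing = isCommutativeRing }

  module CR = CommutativeRing commutativeRing
  open import Algebra.Solver.Ring.NaturalCoefficients.Default CR.commutativeSemiring
    using (solve; _:+_; _:*_; _:=_; con; Polynomial)
  open import Algebra.Properties.Ring CR.ring using (-‿distribˡ-*; -‿distribʳ-*; -‿involutive)
  open import Algebra.Properties.Group CR.+-group using (//-rightDividesˡ)

  poset : Poset 0ℓ 0ℓ 0ℓ
  poset = record { isPartialOrder = IsTotalOrder.isPartialOrder isTotalOrder }

  open Poset poset public using () renaming (refl to ≤-refl; trans to ≤-trans; reflexive to ≤-reflexive)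
  open import Relation.Binary.Reasoning.PartialOrder poset

  +-monoˡ-≤ : ∀ {a b} c → a ≤ b → a + c ≤ b + c
  +-monoˡ-≤ {a} {b} c a≤b = begin
    a + c  ≡⟨ CR.+-comm a c ⟩
    c + a  ≤⟨ +-monoʳ-≤ c a≤b ⟩
    c + b  ≡⟨ CR.+-comm c b ⟩
    b + c  ∎

  +-mono-≤ : ∀ {a b c d} → a ≤ b → c ≤ d → a + c ≤ b + d
  +-mono-≤ {b = b} {c = c} a≤b c≤d = ≤-trans (+-monoˡ-≤ c a≤b) (+-monoʳ-≤ b c≤d)

  x≤y⇒0≤y-x : ∀ {x y} → x ≤ y → 0# ≤ y + - x
  x≤y⇒0≤y-x {x} {y} x≤y = begin
    0#      ≡⟨ CR.-‿inverseʳ x ⟨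
    x + - x ≤⟨ +-monoˡ-≤ (- x) x≤y ⟩
    y + - x ∎

  *-monoˡ-≤-nonNeg : ∀ {a b} c → 0# ≤ c → a ≤ b → c * a ≤ c * b
  *-monoˡ-≤-nonNeg {a} {b} c 0≤c a≤b = begin
    c * a                  ≡⟨ CR.+-identityˡ (c * a) ⟨
    0# + c * a             ≤⟨ +-monoˡ-≤ (c * a) (*-nonneg 0≤c (x≤y⇒0≤y-x a≤b)) ⟩
    c * (b + - a) + c * a  ≡⟨ CR.distribˡ c (b + - a) a ⟨
    c * (b + - a + a)      ≡⟨ cong (c *_) (//-rightDividesˡ a b) ⟩
    c * b                  ∎

  *-monoʳ-≤-nonNeg : ∀ {a b} c → 0# ≤ c → a ≤ b → a * c ≤ b * c
  *-monoʳ-≤-nonNeg {a} {b} c 0≤c a≤b = begin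
    a * c  ≡⟨ CR.*-comm a c ⟩
    c * a  ≤⟨ *-monoˡ-≤-nonNeg c 0≤c a≤b ⟩
    c * b  ≡⟨ CR.*-comm c b ⟩
    b * c  ∎

  *-mono-≤-nonNeg : ∀ {a b c d} → 0# ≤ a → a ≤ b → 0# ≤ c → c ≤ d → a * c ≤ b * d
  *-mono-≤-nonNeg {a} {b} {c} {d} 0≤a a≤b 0≤c c≤d = begin
    a * c  ≤⟨ *-monoˡ-≤-nonNeg a 0≤a c≤d ⟩
    a * d  ≤⟨ *-monoʳ-≤-nonNeg d (≤-trans 0≤c c≤d) a≤b ⟩
    b * d  ∎

  x*x-nonNeg : ∀ x → 0# ≤ x * x
  x*x-nonNeg x with IsTotalOrder.total isTotalOrder 0# x
  ... | inj₁ 0≤x = *-nonneg 0≤x 0≤x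
  ... | inj₂ x≤0 = begin
    0#         ≤⟨ *-nonneg 0≤-x 0≤-x ⟩
    - x * - x  ≡⟨ -‿distribˡ-* x (- x) ⟨
    - (x * - x) ≡⟨ cong -_ (-‿distribʳ-* x x) ⟨
    - - (x * x) ≡⟨ -‿involutive (x * x) ⟩
    x * x      ∎
    where
    0≤-x : 0# ≤ - x
    0≤-x = subst (0# ≤_) (CR.+-identityˡ (- x)) (x≤y⇒0≤y-x x≤0)

  0≤1 : 0# ≤ 1#
  0≤1 = subst (0# ≤_) (CR.*-identityʳ 1#) (x*x-nonNeg 1#)

  fromℕ-nonNeg : ∀ k → 0# ≤ fromℕ R k
  fromℕ-nonNeg zero    = ≤-refl
  fromℕ-nonNeg (suc k) = begin
    0#                ≡⟨ CR.+-identityʳ 0# ⟨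
    0# + 0#           ≤⟨ +-mono-≤ 0≤1 (fromℕ-nonNeg k) ⟩
    1# + fromℕ R k    ∎

  -- Spelled out so as to be fromℕ R 4 on the nose; the solver's own numeral con 4 is not.
  :4 : ∀ {k} → Polynomial k
  :4 = con 1 :+ (con 1 :+ (con 1 :+ (con 1 :+ con 0)))

  -- Writing x as (x - y) + y turns each identity below into one between polynomials without negation.
  x*y+x*y≤x*x+y*y : ∀ x y → x * y + x * y ≤ x * x + y * y
  x*y+x*y≤x*x+y*y x y = begin
    x * y + x * y                       ≡⟨ CR.+-identityˡ _ ⟨
    0# + (x * y + x * y)                ≤⟨ +-monoˡ-≤ _ (x*x-nonNeg d) ⟩
    d * d + (x * y + x * y)             ≡⟨ cong (λ t → d * d + (t * y + t * y)) x≡d+y ⟩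
    d * d + ((d + y) * y + (d + y) * y) ≡⟨ solve 2 (λ d y → d :* d :+ ((d :+ y) :* y :+ (d :+ y) :* y)
                                                        := (d :+ y) :* (d :+ y) :+ y :* y) refl d y ⟩
    (d + y) * (d + y) + y * y           ≡⟨ cong (λ t → t * t + y * y) x≡d+y ⟨
    x * x + y * y                       ∎
    where
    d = x + - y
    x≡d+y : x ≡ d + y
    x≡d+y = sym (//-rightDividesˡ y x)

  4xy≤[x+y]² : ∀ x y → fromℕ R 4 * (x * y) ≤ (x + y) * (x + y)
  4xy≤[x+y]² x y = begin
    fromℕ R 4 * (x * y)                 ≡⟨ CR.+-identityˡ _ ⟨
    0# + fromℕ R 4 * (x * y)            ≤⟨ +-monoˡ-≤ _ (x*x-nonNeg d) ⟩
    d * d + fromℕ R 4 * (x * y)         ≡⟨ cong (λ t → d * d + fromℕ R 4 * (t * y)) x≡d+y ⟩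
    d * d + fromℕ R 4 * ((d + y) * y)   ≡⟨ solve 2 (λ d y → d :* d :+ :4 :* ((d :+ y) :* y)
                                                        := (d :+ y :+ y) :* (d :+ y :+ y)) refl d y ⟩
    (d + y + y) * (d + y + y)           ≡⟨ cong (λ t → (t + y) * (t + y)) x≡d+y ⟨
    (x + y) * (x + y)                   ∎
    where
    d = x + - y
    x≡d+y : x ≡ d + y
    x≡d+y = sym (//-rightDividesˡ y x)

  [x+y]²≤4w : ∀ {x y w} → x * x ≤ w → y * y ≤ w → (x + y) * (x + y) ≤ fromℕ R 4 * w
  [x+y]²≤4w {x} {y} {w} x²≤w y²≤w = begin
    (x + y) * (x + y)                    ≡⟨ solve 2 (λ x y → (x :+ y) :* (x :+ y)
                                                  := (x :* x :+ y :* y) :+ (x :* y :+ x :* y)) refl x y ⟩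
    (x * x + y * y) + (x * y + x * y)    ≤⟨ +-monoʳ-≤ _ (x*y+x*y≤x*x+y*y x y) ⟩
    (x * x + y * y) + (x * x + y * y)    ≤⟨ +-mono-≤ x²+y²≤w+w x²+y²≤w+w ⟩
    (w + w) + (w + w)                    ≡⟨ solve 1 (λ w → (w :+ w) :+ (w :+ w)
                                                  := :4 :* w) refl w ⟩
    fromℕ R 4 * w                        ∎
    where
    x²+y²≤w+w = +-mono-≤ x²≤w y²≤w

  ∑ : List Carrier → Carrier
  ∑ = foldr _+_ 0#

  ∑² : List Carrier → Carrier
  ∑² xs = ∑ (map (λ x → x * x) xs)

  ∑-++ : ∀ xs ys → ∑ (xs ++ ys) ≡ ∑ xs + ∑ ys
  ∑-++ []       ys = sym (CR.+-identityˡ (∑ ys))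
  ∑-++ (x ∷ xs) ys = trans (cong (x +_) (∑-++ xs ys)) (sym (CR.+-assoc x (∑ xs) (∑ ys)))

  ∑²-++ : ∀ xs ys → ∑² (xs ++ ys) ≡ ∑² xs + ∑² ys
  ∑²-++ xs ys = trans (cong ∑ (map-++ _ xs ys)) (∑-++ (map _ xs) (map _ ys))

  module _ {A : Set} where
    ∑-mono : ∀ {f g : A → Carrier} xs → (∀ x → f x ≤ g x) → ∑ (map f xs) ≤ ∑ (map g xs)
    ∑-mono []       f≤g = ≤-refl
    ∑-mono (x ∷ xs) f≤g = +-mono-≤ (f≤g x) (∑-mono xs f≤g)

    ∑-nonNeg : ∀ {f : A → Carrier} xs → (∀ x → 0# ≤ f x) → 0# ≤ ∑ (map f xs)
    ∑-nonNeg     []       0≤f = ≤-refl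
    ∑-nonNeg {f} (x ∷ xs) 0≤f = begin
      0#                  ≡⟨ CR.+-identityʳ 0# ⟨
      0# + 0#             ≤⟨ +-mono-≤ (0≤f x) (∑-nonNeg xs 0≤f) ⟩
      f x + ∑ (map f xs)  ∎

    *-distribˡ-∑ : ∀ c (f : A → Carrier) xs → c * ∑ (map f xs) ≡ ∑ (map (λ x → c * f x) xs)
    *-distribˡ-∑ c f []       = CR.zeroʳ c
    *-distribˡ-∑ c f (x ∷ xs) = trans (CR.distribˡ c (f x) _) (cong (c * f x +_) (*-distribˡ-∑ c f xs))

  2x∑≤n*x²+∑² : ∀ x ys → x * ∑ ys + x * ∑ ys ≤ fromℕ R (length ys) * (x * x) + ∑² ys
  2x∑≤n*x²+∑² x [] = ≤-reflexive (solve 1 (λ x → x :* con 0 :+ x :* con 0 := con 0 :* (x :* x) :+ con 0) refl x)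
  2x∑≤n*x²+∑² x (y ∷ ys) = begin
    x * (y + s) + x * (y + s)             ≡⟨ solve 3 (λ x y s → x :* (y :+ s) :+ x :* (y :+ s)
                                                   := (x :* y :+ x :* y) :+ (x :* s :+ x :* s)) refl x y s ⟩
    (x * y + x * y) + (x * s + x * s)     ≤⟨ +-mono-≤ (x*y+x*y≤x*x+y*y x y) (2x∑≤n*x²+∑² x ys) ⟩
    (x * x + y * y) + (k * (x * x) + Q)   ≡⟨ solve 4 (λ x y k Q → (x :* x :+ y :* y) :+ (k :* (x :* x) :+ Q)
                                                   := (con 1 :+ k) :* (x :* x) :+ (y :* y :+ Q)) refl x y k Q ⟩
    (1# + k) * (x * x) + (y * y + Q)      ∎
    where
    s = ∑ ys
    k = fromℕ R (length ys)
    Q = ∑² ys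

  Cauchy–Schwarz : ∀ xs → ∑ xs * ∑ xs ≤ fromℕ R (length xs) * ∑² xs
  Cauchy–Schwarz [] = ≤-refl
  Cauchy–Schwarz (x ∷ xs) = begin
    (x + s) * (x + s)                      ≡⟨ solve 2 (λ x s → (x :+ s) :* (x :+ s)
                                                    := x :* x :+ ((x :* s :+ x :* s) :+ s :* s)) refl x s ⟩
    x * x + ((x * s + x * s) + s * s)
      ≤⟨ +-monoʳ-≤ (x * x) (+-mono-≤ (2x∑≤n*x²+∑² x xs) (Cauchy–Schwarz xs)) ⟩
    x * x + ((k * (x * x) + Q) + k * Q)    ≡⟨ solve 3 (λ x k Q → x :* x :+ ((k :* (x :* x) :+ Q) :+ k :* Q)
                                                    := (con 1 :+ k) :* (x :* x :+ Q)) refl x k Q ⟩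
    (1# + k) * (x * x + Q)                 ∎
    where
    s = ∑ xs
    k = fromℕ R (length xs)
    Q = ∑² xs

  sumFin-cong : ∀ {K} {f g : Fin K → Carrier} → f ≗ g → sumFin R f ≡ sumFin R g
  sumFin-cong {zero}  f≗g = refl
  sumFin-cong {suc K} f≗g = cong₂ _+_ (f≗g zero) (sumFin-cong (f≗g ∘ suc))

  sumFin-+ : ∀ {K} (f g : Fin K → Carrier) → sumFin R (λ i → f i + g i) ≡ sumFin R f + sumFin R g
  sumFin-+ {zero}  f g = sym (CR.+-identityʳ 0#)
  sumFin-+ {suc K} f g = trans (cong (f zero + g zero +_) (sumFin-+ (f ∘ suc) (g ∘ suc)))
    (solve 4 (λ a b c d → (a :+ b) :+ (c :+ d) := (a :+ c) :+ (b :+ d)) refl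
      (f zero) (g zero) (sumFin R (f ∘ suc)) (sumFin R (g ∘ suc)))

  sumFin-0 : ∀ K → sumFin R {K} (λ _ → 0#) ≡ 0#
  sumFin-0 zero    = refl
  sumFin-0 (suc K) = trans (cong (0# +_) (sumFin-0 K)) (CR.+-identityʳ 0#)

  sumFin-mono : ∀ {K} {f g : Fin K → Carrier} → (∀ i → f i ≤ g i) → sumFin R f ≤ sumFin R g
  sumFin-mono {zero}  f≤g = ≤-refl
  sumFin-mono {suc K} f≤g = +-mono-≤ (f≤g zero) (sumFin-mono (f≤g ∘ suc))

module _ {n m : ℕ} where

  Invariant : (Projection n m → Bool) → Set
  Invariant Z = ∀ {π ρ} → π ≗ ρ → Z π ≡ Z ρ

  ==P⇒≗ : ∀ {π ρ : Projection n m} → (π ==P ρ) ≡ true → π ≗ ρ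
  ==P⇒≗ {π} {ρ} eq = toWitness (Equivalence.from T-≡ (trans (isYes≗does π≟ρ) eq))
    where π≟ρ = all? (λ i → π i ≟T ρ i)

  ≗⇒==P : ∀ {π ρ : Projection n m} → π ≗ ρ → (π ==P ρ) ≡ true
  ≗⇒==P {π} {ρ} = dec-true (all? (λ i → π i ≟T ρ i))

  ==P-refl : ∀ (π : Projection n m) → (π ==P π) ≡ true
  ==P-refl π = ≗⇒==P (λ _ → refl)

  ==P-separates : ∀ {ρ π π′ : Projection n m} →
    (ρ ==P π′) ≡ true → (π ==P π′) ≡ false → (ρ ==P π) ≡ false
  ==P-separates {ρ} {π} ρ≗π′ π≢π′ with ρ ==P π in ρ≗π
  ... | false = refl
  ... | true  = trans (sym (≗⇒==P (λ i → trans (sym (==P⇒≗ ρ≗π i)) (==P⇒≗ ρ≗π′ i)))) π≢π′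

  _∈ᵇ_ : Projection n m → List (Projection n m) → Bool
  π ∈ᵇ πs = any (π ==P_) πs

  Distinct : List (Projection n m) → Set
  Distinct = AllPairs (λ π ρ → (π ==P ρ) ≡ false)

  ∉ᵇ⇒All≢ : ∀ {π} πs → (π ∈ᵇ πs) ≡ false → All (λ ρ → (π ==P ρ) ≡ false) πs
  ∉ᵇ⇒All≢     []       _    = []
  ∉ᵇ⇒All≢ {π} (ρ ∷ πs) π∉πs = proj₁ split ∷ ∉ᵇ⇒All≢ πs (proj₂ split)
    where split = ∨-≡-false (π ==P ρ) π∉πs

  insert : Projection n m → List (Projection n m) → List (Projection n m)
  insert π πs = if π ∈ᵇ πs then πs else π ∷ πs

  ∈ᵇ-insert : ∀ π πs → (π ∈ᵇ insert π πs) ≡ true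
  ∈ᵇ-insert π πs with π ∈ᵇ πs in π∈πs
  ... | true  = π∈πs
  ... | false rewrite ==P-refl π = refl

  ∈ᵇ-insert⁺ : ∀ {ρ} π πs → (ρ ∈ᵇ πs) ≡ true → (ρ ∈ᵇ insert π πs) ≡ true
  ∈ᵇ-insert⁺ {ρ} π πs ρ∈πs with π ∈ᵇ πs
  ... | true  = ρ∈πs
  ... | false rewrite ρ∈πs = ∨-zeroʳ (ρ ==P π)

  insert-distinct : ∀ π {πs} → Distinct πs → Distinct (insert π πs)
  insert-distinct π {πs} distinct with π ∈ᵇ πs in π∈πs
  ... | true  = distinct
  ... | false = ∉ᵇ⇒All≢ πs π∈πs ∷ distinct

  image : ∀ {K} → (Fin K → Projection n m) → List (Projection n m)
  image {zero}  κ = []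
  image {suc K} κ = insert (κ zero) (image (κ ∘ suc))

  image-covers : ∀ {K} (κ : Fin K → Projection n m) ω → (κ ω ∈ᵇ image κ) ≡ true
  image-covers κ zero    = ∈ᵇ-insert (κ zero) (image (κ ∘ suc))
  image-covers κ (suc ω) = ∈ᵇ-insert⁺ (κ zero) (image (κ ∘ suc)) (image-covers (κ ∘ suc) ω)

  image-distinct : ∀ {K} (κ : Fin K → Projection n m) → Distinct (image κ)
  image-distinct {zero}  κ = []
  image-distinct {suc K} κ = insert-distinct (κ zero) (image-distinct (κ ∘ suc))

isLiteral : ∀ {m} → Target m → Bool
isLiteral (const _) = false
isLiteral (lit _)   = true

pinnedAt : ∀ {n m} → Projection n m → Target m → Bool → Projection n m
pinnedAt ρ (const _) σ = ρ
pinnedAt ρ (lit ℓ)   σ = substP ρ (var ℓ) σ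

pinned : ∀ {n m} → Projection n m → Fin n → Bool → Projection n m
pinned ρ i σ = pinnedAt ρ (ρ i) σ

module _ {n : ℕ} where

  evalLit-var : ∀ (ℓ : Lit n) {x y} → x (var ℓ) ≡ y (var ℓ) → evalLit ℓ x ≡ evalLit ℓ y
  evalLit-var (pos i) xᵢ≡yᵢ = xᵢ≡yᵢ
  evalLit-var (neg i) xᵢ≡yᵢ = cong not xᵢ≡yᵢ

  evalF-cong : ∀ (G : Formula n) {x y} → x ≗ y → evalF G x ≡ evalF G y
  evalF-cong (leaf ℓ)  x≗y = evalLit-var ℓ (x≗y (var ℓ))
  evalF-cong (and G H) x≗y = cong₂ _∧_ (evalF-cong G x≗y) (evalF-cong H x≗y)
  evalF-cong (or G H)  x≗y = cong₂ _∨_ (evalF-cong G x≗y) (evalF-cong H x≗y)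

  evalLit-separates : ∀ (ℓ : Lit n) {x y} →
    evalLit ℓ x ≡ false → evalLit ℓ y ≡ true → x (var ℓ) ≢ y (var ℓ)
  evalLit-separates ℓ ℓx≡0 ℓy≡1 xᵢ≡yᵢ
    with () ← trans (sym ℓx≡0) (trans (evalLit-var ℓ xᵢ≡yᵢ) ℓy≡1)

  firstVariable : Formula n → Fin n
  firstVariable (leaf ℓ)  = var ℓ
  firstVariable (and G _) = firstVariable G
  firstVariable (or G _)  = firstVariable G

  leaves-pos : ∀ (G : Formula n) → 1 ℕ.≤ leaves G
  leaves-pos (leaf _)  = ℕ.s≤s ℕ.z≤n
  leaves-pos (and G H) = ℕP.≤-trans (leaves-pos G) (ℕP.m≤m+n _ _)
  leaves-pos (or G H)  = ℕP.≤-trans (leaves-pos G) (ℕP.m≤m+n _ _)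

  two-leaves : ∀ (G H : Formula n) → leaves G ℕ.+ leaves H ≢ 1
  two-leaves G H size≡1 with subst (2 ℕ.≤_) size≡1 (ℕP.+-mono-≤ (leaves-pos G) (leaves-pos H))
  ... | ℕ.s≤s ()

  HasL-1⇒literal : ∀ {g : BoolFun n} → HasL g 1 → Σ (Lit n) λ ℓ → Computes (leaf ℓ) g
  HasL-1⇒literal (inj₁ (_ , ()))
  HasL-1⇒literal (inj₂ (_ , (leaf ℓ  , ℓ-computes , _) , _)) = ℓ , ℓ-computes
  HasL-1⇒literal (inj₂ (_ , (and G H , _ , size≡1) , _)) = ⊥-elim (two-leaves G H size≡1)
  HasL-1⇒literal (inj₂ (_ , (or G H  , _ , size≡1) , _)) = ⊥-elim (two-leaves G H size≡1)

  Constant⇒¬HasL-1 : ∀ {g : BoolFun n} → Constant g → ¬ HasL g 1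
  Constant⇒¬HasL-1 g-const (inj₁ (_ , ()))
  Constant⇒¬HasL-1 g-const (inj₂ (g-nonconst , _)) = g-nonconst g-const

module _ {m : ℕ} where

  assign : Fin m → Bool → Fin m → Bool
  assign j c k = if does (k ≟F j) then c else false

  evalT-substT : ∀ (t : Target m) j c → evalT (substT t j c) (λ _ → false) ≡ evalT t (assign j c)
  evalT-substT (const b)     j c = refl
  evalT-substT (lit (pos k)) j c with does (k ≟F j)
  ... | true  = refl
  ... | false = refl
  evalT-substT (lit (neg k)) j c with does (k ≟F j)
  ... | true  = refl
  ... | false = refl

  settingTo : Lit m → Bool → Bool
  settingTo (pos _) τ = τ
  settingTo (neg _) τ = not τ

  settingTo-not : ∀ ℓ → settingTo ℓ true ≡ not (settingTo ℓ false)
  settingTo-not (pos _) = refl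
  settingTo-not (neg _) = refl

  evalLit-settingTo : ∀ ℓ τ → evalLit ℓ (assign (var ℓ) (settingTo ℓ τ)) ≡ τ
  evalLit-settingTo (pos j) τ rewrite dec-true (j ≟F j) refl = refl
  evalLit-settingTo (neg j) τ rewrite dec-true (j ≟F j) refl = not-involutive τ

  substT-sensitive : ∀ (t : Target m) j b →
    evalT (substT t j b) (λ _ → false) ≢ evalT (substT t j (not b)) (λ _ → false) →
    Σ (Lit m) λ ℓ → t ≡ lit ℓ × var ℓ ≡ j
  substT-sensitive (const c)     j b differ = ⊥-elim (differ refl)
  substT-sensitive (lit (pos k)) j b differ with k ≟F j
  ... | yes k≡j = pos k , refl , k≡j
  ... | no  _   = ⊥-elim (differ refl)
  substT-sensitive (lit (neg k)) j b differ with k ≟F j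
  ... | yes k≡j = neg k , refl , k≡j
  ... | no  _   = ⊥-elim (differ refl)

module _ {n m : ℕ} where

  restrict-Constant : ∀ {f : BoolFun n} (π : Projection n m) → Constant f → Constant (restrict f π)
  restrict-Constant π (b , f≡b) = b , λ y → f≡b _

  point : Projection n m → Fin n → Bool
  point ρ i = evalT (ρ i) (λ _ → false)

  point-cong : ∀ {π ρ} → π ≗ ρ → point π ≗ point ρ
  point-cong π≗ρ i = cong (λ t → evalT t (λ _ → false)) (π≗ρ i)

  holds : Formula n → Projection n m → Bool
  holds G ρ = evalF G (point ρ)

  holds-invariant : ∀ G → Invariant (holds G)
  holds-invariant G π≗ρ = evalF-cong G (point-cong π≗ρ)

  point-substP : ∀ (π : Projection n m) j c → point (substP π j c) ≗ (λ i → evalT (π i) (assign j c))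
  point-substP π j c i = evalT-substT (π i) j c

  pinned-lit : ∀ (π : Projection n m) i {ℓ} → π i ≡ lit ℓ → ∀ σ → pinned π i σ ≡ substP π (var ℓ) σ
  pinned-lit π i πᵢ≡ℓ σ = cong (λ t → pinnedAt π t σ) πᵢ≡ℓ

module Probability {R : OrderedCommRing} {n m : ℕ} (p : RandomProjection R n m) where
  open OrderedCommRing R
  open OrderedCommRingProperties R
  open RandomProjection p
  open import Relation.Binary.Reasoning.PartialOrder poset

  Event : Set
  Event = Fin N → Bool

  _⊆_ : Event → Event → Set
  E ⊆ F = ∀ ω → E ω ≡ true → F ω ≡ true

  _∩_ : Event → Event → Event
  (E ∩ F) ω = E ω ∧ F ω

  ∁ : Event → Event
  ∁ E ω = not (E ω)

  weightIf : Bool → Fin N → Carrier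
  weightIf b ω = if b then weight ω else 0#

  weightIf-nonNeg : ∀ b ω → 0# ≤ weightIf b ω
  weightIf-nonNeg true  ω = weight-nonneg ω
  weightIf-nonNeg false ω = ≤-refl

  Pr-cong : ∀ {E F} → E ≗ F → Pr p E ≡ Pr p F
  Pr-cong E≗F = sumFin-cong (λ ω → cong (λ b → weightIf b ω) (E≗F ω))

  Pr-∅ : ∀ {E} → (∀ ω → E ω ≡ false) → Pr p E ≡ 0#
  Pr-∅ E≗∅ = trans (Pr-cong E≗∅) (sumFin-0 N)

  Pr-nonNeg : ∀ E → 0# ≤ Pr p E
  Pr-nonNeg E = begin
    0#                      ≡⟨ sumFin-0 N ⟨
    sumFin R {N} (λ _ → 0#) ≤⟨ sumFin-mono (λ ω → weightIf-nonNeg (E ω) ω) ⟩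
    Pr p E                  ∎

  Pr-mono : ∀ {E F} → E ⊆ F → Pr p E ≤ Pr p F
  Pr-mono {E} {F} E⊆F = sumFin-mono pointwise
    where
    pointwise : ∀ ω → weightIf (E ω) ω ≤ weightIf (F ω) ω
    pointwise ω with E ω | E⊆F ω
    ... | true  | ω∈F rewrite ω∈F refl = ≤-refl
    ... | false | _    = weightIf-nonNeg (F ω) ω

  Pr-split : ∀ C E → Pr p E ≡ Pr p (C ∩ E) + Pr p (∁ C ∩ E)
  Pr-split C E =
    trans (sumFin-cong pointwise) (sumFin-+ (λ ω → weightIf ((C ∩ E) ω) ω) (λ ω → weightIf ((∁ C ∩ E) ω) ω))
    where
    pointwise : ∀ ω → weightIf (E ω) ω ≡ weightIf ((C ∩ E) ω) ω + weightIf ((∁ C ∩ E) ω) ω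
    pointwise ω with C ω
    ... | true  = sym (CR.+-identityʳ _)
    ... | false = sym (CR.+-identityˡ _)

  Pr-⊆-∪ : ∀ {T E F} → (∀ ω → T ω ≡ true → E ω ≡ true ⊎ F ω ≡ true) → Pr p T ≤ Pr p E + Pr p F
  Pr-⊆-∪ {T} {E} {F} T⊆E∪F = begin
    Pr p T                             ≡⟨ Pr-split E T ⟩
    Pr p (E ∩ T) + Pr p (∁ E ∩ T)      ≤⟨ +-mono-≤ (Pr-mono E∩T⊆E) (Pr-mono ∁E∩T⊆F) ⟩
    Pr p E + Pr p F                    ∎
    where
    E∩T⊆E : (E ∩ T) ⊆ E
    E∩T⊆E ω ω∈E∩T with E ω
    ... | true = refl
    ∁E∩T⊆F : (∁ E ∩ T) ⊆ F
    ∁E∩T⊆F ω ω∈∁E∩T with E ω | T⊆E∪F ω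
    ... | false | ω∈E∪F with ω∈E∪F ω∈∁E∩T
    ...   | inj₂ ω∈F = ω∈F

  Pr-decompose : ∀ (κ : Fin N → Projection n m) D {πs} → Distinct πs →
    Pr p (λ ω → D ω ∧ (κ ω ∈ᵇ πs)) ≡ ∑ (map (λ π → Pr p (λ ω → D ω ∧ (κ ω ==P π))) πs)
  Pr-decompose κ D {[]}     []                 = Pr-∅ (λ ω → ∧-zeroʳ (D ω))
  Pr-decompose κ D {π ∷ πs} (π≢πs ∷ distinct) = begin-equality
    Pr p (λ ω → D ω ∧ (C ω ∨ M ω))
      ≡⟨ Pr-split C _ ⟩
    Pr p (C ∩ (λ ω → D ω ∧ (C ω ∨ M ω))) + Pr p (∁ C ∩ (λ ω → D ω ∧ (C ω ∨ M ω)))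
      ≡⟨ cong₂ _+_ (Pr-cong (λ ω → inside (C ω) (D ω) (M ω)))
                   (Pr-cong (λ ω → outside (C ω) (D ω) (M ω))) ⟩
    Pr p (λ ω → D ω ∧ C ω) + Pr p (λ ω → (∁ C ∩ D) ω ∧ M ω)
      ≡⟨ cong (Pr p (λ ω → D ω ∧ C ω) +_) (Pr-decompose κ (∁ C ∩ D) distinct) ⟩
    Pr p (λ ω → D ω ∧ C ω) + ∑ (map (λ π′ → Pr p (λ ω → (∁ C ∩ D) ω ∧ (κ ω ==P π′))) πs)
      ≡⟨ cong (λ xs → Pr p (λ ω → D ω ∧ C ω) + ∑ xs) (map-cong-local (All.map fibre-avoids-π π≢πs)) ⟩
    Pr p (λ ω → D ω ∧ C ω) + ∑ (map (λ π′ → Pr p (λ ω → D ω ∧ (κ ω ==P π′))) πs)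
      ∎
    where
    C M : Event
    C ω = κ ω ==P π
    M ω = κ ω ∈ᵇ πs

    inside : ∀ c d m → c ∧ (d ∧ (c ∨ m)) ≡ d ∧ c
    inside true  d m = refl
    inside false d m = sym (∧-zeroʳ d)

    outside : ∀ c d m → not c ∧ (d ∧ (c ∨ m)) ≡ (not c ∧ d) ∧ m
    outside true  d m = refl
    outside false d m = refl

    fibre-avoids-π : ∀ {π′} → (π ==P π′) ≡ false →
      Pr p (λ ω → (∁ C ∩ D) ω ∧ (κ ω ==P π′)) ≡ Pr p (λ ω → D ω ∧ (κ ω ==P π′))
    fibre-avoids-π {π′} π≢π′ = Pr-cong pointwise
      where
      pointwise : ∀ ω → (not (C ω) ∧ D ω) ∧ (κ ω ==P π′) ≡ D ω ∧ (κ ω ==P π′)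
      pointwise ω with κ ω ==P π′ in κω≗π′
      ... | true  = cong (λ c → (not c ∧ D ω) ∧ true) (==P-separates {ρ = κ ω} {π} {π′} κω≗π′ π≢π′)
      ... | false = trans (∧-zeroʳ _) (sym (∧-zeroʳ (D ω)))

  Constant⇒Pr≡0 : ∀ {f : BoolFun n} → Constant f →
    ∀ S → (∀ ω → S ω ≡ true → HasL (restrict f (proj ω)) 1) → Pr p S ≡ 0#
  Constant⇒Pr≡0 f-constant S S⇒L1 = Pr-∅ S-empty
    where
    S-empty : ∀ ω → S ω ≡ false
    S-empty ω with S ω in ω∈S
    ... | false = refl
    ... | true  = ⊥-elim (Constant⇒¬HasL-1 (restrict-Constant (proj ω) f-constant) (S⇒L1 ω ω∈S))

module FixingConsequences {R : OrderedCommRing} {n m : ℕ} (p : RandomProjection R n m)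
  (q₀ q₁ : OrderedCommRing.Carrier R) (fixing : Fixing p q₀ q₁) where
  open OrderedCommRing R
  open OrderedCommRingProperties R
  open RandomProjection p
  open Probability p
  open import Relation.Binary.Reasoning.PartialOrder poset

  q : Bool → Carrier
  q σ = if σ then q₁ else q₀

  -- Nonnegativity of q₀, q₁ is not assumed: it follows by summing the fixing inequality over all
  -- values of p, as long as there is an input variable to apply it to.
  q-nonNeg : Fin n → ∀ σ → 0# ≤ q σ
  q-nonNeg i σ = begin
    0#
      ≤⟨ ∑-nonNeg πs (λ π → ≤-trans (Pr-nonNeg _) (fixing π σ i)) ⟩
    ∑ (map (λ π → q σ * Pr p (ev-eq p π)) πs)
      ≡⟨ *-distribˡ-∑ (q σ) (λ π → Pr p (ev-eq p π)) πs ⟨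
    q σ * ∑ (map (λ π → Pr p (ev-eq p π)) πs)
      ≡⟨ cong (q σ *_) (Pr-decompose proj (λ _ → true) (image-distinct proj)) ⟨
    q σ * Pr p (λ ω → proj ω ∈ᵇ πs)
      ≡⟨ cong (q σ *_) (trans (Pr-cong (image-covers proj)) weight-sum) ⟩
    q σ * 1#
      ≡⟨ CR.*-identityʳ (q σ) ⟩
    q σ
      ∎
    where
    πs = image proj

  Pinned : Fin n → Bool → (Projection n m → Bool) → Event
  Pinned i σ Z ω = isLiteral (proj ω i) ∧ Z (pinned (proj ω) i σ)

  ev-fix≡ : ∀ i σ π ω → ev-fix p i σ π ω ≡ isLiteral (proj ω i) ∧ (pinned (proj ω) i σ ==P π)
  ev-fix≡ i σ π ω with proj ω i
  ... | const _ = refl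
  ... | lit _   = refl

  Pinned-fibre≤ : ∀ i σ {Z} → Invariant Z → ∀ π →
    Pr p (λ ω → Pinned i σ Z ω ∧ (pinned (proj ω) i σ ==P π))
      ≤ q σ * Pr p (λ ω → Z (proj ω) ∧ (proj ω ==P π))
  Pinned-fibre≤ i σ {Z} invZ π with Z π in Zπ
  ... | true  = begin
    Pr p (λ ω → Pinned i σ Z ω ∧ (pinned (proj ω) i σ ==P π))  ≤⟨ Pr-mono ⊆ev-fix ⟩
    Pr p (ev-fix p i σ π)                                       ≤⟨ fixing π σ i ⟩
    q σ * Pr p (ev-eq p π)                                      ≡⟨ cong (q σ *_) (Pr-cong within-Z) ⟩
    q σ * Pr p (λ ω → Z (proj ω) ∧ (proj ω ==P π))              ∎
    where
    ⊆ev-fix : (λ ω → Pinned i σ Z ω ∧ (pinned (proj ω) i σ ==P π)) ⊆ ev-fix p i σ π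
    ⊆ev-fix ω ω∈ = trans (ev-fix≡ i σ π ω) (cong₂ _∧_ literal (proj₂ split))
      where
      split = ∧-≡-true (Pinned i σ Z ω) ω∈
      literal = proj₁ (∧-≡-true (isLiteral (proj ω i)) (proj₁ split))
    within-Z : ∀ ω → (proj ω ==P π) ≡ Z (proj ω) ∧ (proj ω ==P π)
    within-Z ω with proj ω ==P π in ω∈fibre
    ... | true  = sym (trans (∧-identityʳ _) (trans (invZ (==P⇒≗ ω∈fibre)) Zπ))
    ... | false = sym (∧-zeroʳ _)
  ... | false = begin
    Pr p (λ ω → Pinned i σ Z ω ∧ (pinned (proj ω) i σ ==P π))  ≡⟨ Pr-∅ pinned-empty ⟩
    0#                                                          ≡⟨ CR.zeroʳ (q σ) ⟨
    q σ * 0#                                                    ≡⟨ cong (q σ *_) (Pr-∅ fibre-empty) ⟨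
    q σ * Pr p (λ ω → Z (proj ω) ∧ (proj ω ==P π))              ∎
    where
    pinned-empty : ∀ ω → Pinned i σ Z ω ∧ (pinned (proj ω) i σ ==P π) ≡ false
    pinned-empty ω with pinned (proj ω) i σ ==P π in ω∈fibre
    ... | true  = trans (∧-identityʳ _)
                    (trans (cong (isLiteral (proj ω i) ∧_) (trans (invZ (==P⇒≗ ω∈fibre)) Zπ)) (∧-zeroʳ _))
    ... | false = ∧-zeroʳ _
    fibre-empty : ∀ ω → Z (proj ω) ∧ (proj ω ==P π) ≡ false
    fibre-empty ω with proj ω ==P π in ω∈fibre
    ... | true  = trans (∧-identityʳ _) (trans (invZ (==P⇒≗ ω∈fibre)) Zπ)
    ... | false = ∧-zeroʳ _

  Pr-Pinned≤ : ∀ i σ {Z} → Invariant Z → Pr p (Pinned i σ Z) ≤ q σ * Pr p (Z ∘ proj)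
  Pr-Pinned≤ i σ {Z} invZ = begin
    Pr p (Pinned i σ Z)
      ≡⟨ Pr-cong covered ⟩
    Pr p (λ ω → Pinned i σ Z ω ∧ (κ ω ∈ᵇ πs))
      ≡⟨ Pr-decompose κ (Pinned i σ Z) (image-distinct κ) ⟩
    ∑ (map (λ π → Pr p (λ ω → Pinned i σ Z ω ∧ (κ ω ==P π))) πs)
      ≤⟨ ∑-mono πs (Pinned-fibre≤ i σ invZ) ⟩
    ∑ (map (λ π → q σ * Pr p (λ ω → Z (proj ω) ∧ (proj ω ==P π))) πs)
      ≡⟨ *-distribˡ-∑ (q σ) _ πs ⟨
    q σ * ∑ (map (λ π → Pr p (λ ω → Z (proj ω) ∧ (proj ω ==P π))) πs)
      ≡⟨ cong (q σ *_) (Pr-decompose proj (Z ∘ proj) (image-distinct κ)) ⟨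
    q σ * Pr p (λ ω → Z (proj ω) ∧ (proj ω ∈ᵇ πs))
      ≤⟨ *-monoˡ-≤-nonNeg (q σ) (q-nonNeg i σ) (Pr-mono (λ ω → proj₁ ∘ ∧-≡-true _)) ⟩
    q σ * Pr p (Z ∘ proj)
      ∎
    where
    κ : Fin N → Projection n m
    κ ω = pinned (proj ω) i σ
    πs = image κ
    covered : ∀ ω → Pinned i σ Z ω ≡ Pinned i σ Z ω ∧ (κ ω ∈ᵇ πs)
    covered ω = sym (trans (cong (Pinned i σ Z ω ∧_) (image-covers κ ω)) (∧-identityʳ _))

module OneLeafRestrictions {R : OrderedCommRing} {n m : ℕ} (f : BoolFun n) (p : RandomProjection R n m)
  (q₀ q₁ : OrderedCommRing.Carrier R) (fixing : Fixing p q₀ q₁)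
  (S : Fin (RandomProjection.N p) → Bool)
  (S⇒L1 : ∀ ω → S ω ≡ true → HasL (restrict f (RandomProjection.proj p ω)) 1)
  (F : Formula n) (F-computes : Computes F f) where
  open OrderedCommRing R
  open OrderedCommRingProperties R
  open RandomProjection p
  open Probability p
  open FixingConsequences p q₀ q₁ fixing
  open import Algebra.Solver.Ring.NaturalCoefficients.Default CR.commutativeSemiring
    using (solve; _:+_; _:*_; _:=_)
  open import Relation.Binary.Reasoning.PartialOrder poset

  -- For ω ∈ S, f|_{p(ω)} is a literal ℓ; pin ω τ is p(ω) with var ℓ set so that f|_{p(ω)} becomes τ.
  -- The membership proof is abstracted so that the lemmas below can match on it.
  pinWith : ∀ ω b → S ω ≡ b → Bool → Projection n m
  pinWith ω true  ω∈S τ = substP (proj ω) (var ℓ) (settingTo ℓ τ)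
    where ℓ = proj₁ (HasL-1⇒literal (S⇒L1 ω ω∈S))
  pinWith ω false _   τ = proj ω

  pin : Fin N → Bool → Projection n m
  pin ω = pinWith ω (S ω) refl

  pinWith-value : ∀ ω {b} (ω∈S : S ω ≡ b) → b ≡ true → ∀ τ → holds F (pinWith ω b ω∈S τ) ≡ τ
  pinWith-value ω ω∈S refl τ =
    trans (evalF-cong F (point-substP (proj ω) (var ℓ) (settingTo ℓ τ)))
      (trans (F-computes _) (trans (sym (ℓ-computes _)) (evalLit-settingTo ℓ τ)))
    where open Σ (HasL-1⇒literal (S⇒L1 ω ω∈S)) renaming (proj₁ to ℓ; proj₂ to ℓ-computes)

  pinWith-substP : ∀ ω {b} (ω∈S : S ω ≡ b) → b ≡ true → Σ (Fin m) λ j → Σ Bool λ c →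
    pinWith ω b ω∈S false ≡ substP (proj ω) j c × pinWith ω b ω∈S true ≡ substP (proj ω) j (not c)
  pinWith-substP ω ω∈S refl =
    var ℓ , settingTo ℓ false , refl , cong (substP (proj ω) (var ℓ)) (settingTo-not ℓ)
    where ℓ = proj₁ (HasL-1⇒literal (S⇒L1 ω ω∈S))

  μ : (Projection n m → Bool) → Carrier
  μ Z = Pr p (Z ∘ proj)

  -- The sample points T have their two pinnings on opposite sides Z, O of G, as in a Karchmer–Wigderson game.
  record Rectangle (G : Formula n) : Set where
    field
      T           : Event
      Z O         : Projection n m → Bool
      Z-invariant : Invariant Z
      O-invariant : Invariant O
      Z⇒G≡0      : ∀ ρ → Z ρ ≡ true → holds G ρ ≡ false
      O⇒G≡1      : ∀ ρ → O ρ ≡ true → holds G ρ ≡ true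
      T-pins      : ∀ ω → T ω ≡ true → S ω ≡ true × Z (pin ω false) ≡ true × O (pin ω true) ≡ true

  record Cover (k : ℕ) (t w : Carrier) : Set where
    field
      shares  : List Carrier
      length≡ : length shares ≡ k
      ∑≡      : ∑ shares ≡ t
      ∑²≤     : ∑² shares ≤ fromℕ R 4 * (q₀ * q₁ * w)

  cover-++ : ∀ {k₁ k₂ t₁ t₂ w₁ w₂} →
    Cover k₁ t₁ w₁ → Cover k₂ t₂ w₂ → Cover (k₁ ℕ.+ k₂) (t₁ + t₂) (w₁ + w₂)
  cover-++ {w₁ = w₁} {w₂} c₁ c₂ = record
    { shares  = C₁.shares ++ C₂.shares
    ; length≡ = trans (length-++ C₁.shares) (cong₂ ℕ._+_ C₁.length≡ C₂.length≡)
    ; ∑≡      = trans (∑-++ C₁.shares C₂.shares) (cong₂ _+_ C₁.∑≡ C₂.∑≡)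
    ; ∑²≤     = begin
        ∑² (C₁.shares ++ C₂.shares)                              ≡⟨ ∑²-++ C₁.shares C₂.shares ⟩
        ∑² C₁.shares + ∑² C₂.shares                              ≤⟨ +-mono-≤ C₁.∑²≤ C₂.∑²≤ ⟩
        fromℕ R 4 * (q₀ * q₁ * w₁) + fromℕ R 4 * (q₀ * q₁ * w₂)  ≡⟨ distrib (fromℕ R 4) (q₀ * q₁) w₁ w₂ ⟩
        fromℕ R 4 * (q₀ * q₁ * (w₁ + w₂))                        ∎
    }
    where
    module C₁ = Cover c₁
    module C₂ = Cover c₂
    distrib : ∀ a b x y → a * (b * x) + a * (b * y) ≡ a * (b * (x + y))
    distrib = solve 4 (λ a b x y → a :* (b :* x) :+ a :* (b :* y) := a :* (b :* (x :+ y))) refl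

  q-product : ∀ b → q b * q (not b) ≡ q₀ * q₁
  q-product true  = CR.*-comm q₁ q₀
  q-product false = refl

  Straddles : Fin n → Bool → (Projection n m → Bool) → (Projection n m → Bool) → Event
  Straddles i b Z O = Pinned i b Z ∩ Pinned i (not b) O

  Pr-Straddles² : ∀ i b {Z O} → Invariant Z → Invariant O →
    Pr p (Straddles i b Z O) * Pr p (Straddles i b Z O) ≤ q₀ * q₁ * (μ Z * μ O)
  Pr-Straddles² i b {Z} {O} Z-inv O-inv = begin
    x * x                          ≤⟨ *-mono-≤-nonNeg (Pr-nonNeg _) x≤qμZ (Pr-nonNeg _) x≤qμO ⟩
    (q b * μ Z) * (q (not b) * μ O) ≡⟨ solve 4 (λ a b z o → (a :* z) :* (b :* o) := (a :* b) :* (z :* o)) refl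
                                                (q b) (q (not b)) (μ Z) (μ O) ⟩
    q b * q (not b) * (μ Z * μ O)  ≡⟨ cong (_* (μ Z * μ O)) (q-product b) ⟩
    q₀ * q₁ * (μ Z * μ O)          ∎
    where
    x = Pr p (Straddles i b Z O)
    x≤qμZ : x ≤ q b * μ Z
    x≤qμZ = ≤-trans (Pr-mono (λ ω → proj₁ ∘ ∧-≡-true _)) (Pr-Pinned≤ i b Z-inv)
    x≤qμO : x ≤ q (not b) * μ O
    x≤qμO = ≤-trans (Pr-mono (λ ω → proj₂ ∘ ∧-≡-true (Pinned i b Z ω))) (Pr-Pinned≤ i (not b) O-inv)

  -- The two pinnings of ω differ only at the pinned y_j, yet the leaf separates them:
  -- so p(ω) reads the leaf's variable through y_j.
  leaf-straddles : ∀ ℓ₀ (r : Rectangle (leaf ℓ₀)) ω → Rectangle.T r ω ≡ true →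
    Σ Bool λ b → Straddles (var ℓ₀) b (Rectangle.Z r) (Rectangle.O r) ω ≡ true
  leaf-straddles ℓ₀ r ω ω∈T = b , cong₂ _∧_ (cong₂ _∧_ literal Z-side) (cong₂ _∧_ literal O-side)
    where
    open Rectangle r
    i = var ℓ₀
    π = proj ω
    pins = T-pins ω ω∈T
    Zζ = proj₁ (proj₂ pins)
    Oη = proj₂ (proj₂ pins)
    spec = pinWith-substP ω refl (proj₁ pins)
    j = proj₁ spec
    b = proj₁ (proj₂ spec)
    ζ≡ = proj₁ (proj₂ (proj₂ spec))
    η≡ = proj₂ (proj₂ (proj₂ spec))
    differ : point (substP π j b) i ≢ point (substP π j (not b)) i
    differ = evalLit-separates ℓ₀
      (subst (λ ρ → evalLit ℓ₀ (point ρ) ≡ false) ζ≡ (Z⇒G≡0 _ Zζ))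
      (subst (λ ρ → evalLit ℓ₀ (point ρ) ≡ true) η≡ (O⇒G≡1 _ Oη))
    read = substT-sensitive (π i) j b differ
    literal : isLiteral (π i) ≡ true
    literal = cong isLiteral (proj₁ (proj₂ read))
    pinned≡ : ∀ σ → pinned π i σ ≡ substP π j σ
    pinned≡ σ = trans (pinned-lit π i (proj₁ (proj₂ read)) σ) (cong (λ k → substP π k σ) (proj₂ (proj₂ read)))
    Z-side : Z (pinned π i b) ≡ true
    Z-side = trans (cong Z (trans (pinned≡ b) (sym ζ≡))) Zζ
    O-side : O (pinned π i (not b)) ≡ true
    O-side = trans (cong O (trans (pinned≡ (not b)) (sym η≡))) Oη

  -- A rectangle for G₁ ∧ G₂ splits according to whether G₁ already fails at the 0-side pinning.
  and-left : ∀ {G₁ G₂} → Rectangle (and G₁ G₂) → Rectangle G₁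
  and-left {G₁} r = record
    { T = λ ω → not (holds G₁ (pin ω false)) ∧ T ω
    ; Z = λ ρ → not (holds G₁ ρ) ∧ Z ρ
    ; O = O
    ; Z-invariant = λ π≗ρ → cong₂ (λ a b → not a ∧ b) (holds-invariant G₁ π≗ρ) (Z-invariant π≗ρ)
    ; O-invariant = O-invariant
    ; Z⇒G≡0 = λ ρ ρ∈Z → not-≡-true (proj₁ (∧-≡-true _ ρ∈Z))
    ; O⇒G≡1 = λ ρ ρ∈O → proj₁ (∧-≡-true _ (O⇒G≡1 ρ ρ∈O))
    ; T-pins = λ ω ω∈T′ → let (ω∈S , Zζ , Oη) = T-pins ω (proj₂ (∧-≡-true _ ω∈T′)) in
        ω∈S , cong₂ _∧_ (proj₁ (∧-≡-true _ ω∈T′)) Zζ , Oη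
    }
    where open Rectangle r

  and-right : ∀ {G₁ G₂} → Rectangle (and G₁ G₂) → Rectangle G₂
  and-right {G₁} r = record
    { T = λ ω → holds G₁ (pin ω false) ∧ T ω
    ; Z = λ ρ → holds G₁ ρ ∧ Z ρ
    ; O = O
    ; Z-invariant = λ π≗ρ → cong₂ _∧_ (holds-invariant G₁ π≗ρ) (Z-invariant π≗ρ)
    ; O-invariant = O-invariant
    ; Z⇒G≡0 = λ ρ ρ∈Z → let (G₁≡1 , ρ∈Z′) = ∧-≡-true _ ρ∈Z in
        ∧-≡-false G₁≡1 (Z⇒G≡0 ρ ρ∈Z′)
    ; O⇒G≡1 = λ ρ ρ∈O → proj₂ (∧-≡-true (holds G₁ ρ) (O⇒G≡1 ρ ρ∈O))
    ; T-pins = λ ω ω∈T′ → let (ω∈S , Zζ , Oη) = T-pins ω (proj₂ (∧-≡-true _ ω∈T′)) in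
        ω∈S , cong₂ _∧_ (proj₁ (∧-≡-true _ ω∈T′)) Zζ , Oη
    }
    where open Rectangle r

  -- Dually, a rectangle for G₁ ∨ G₂ splits according to whether G₁ already holds at the 1-side pinning.
  or-left : ∀ {G₁ G₂} → Rectangle (or G₁ G₂) → Rectangle G₁
  or-left {G₁} r = record
    { T = λ ω → holds G₁ (pin ω true) ∧ T ω
    ; Z = Z
    ; O = λ ρ → holds G₁ ρ ∧ O ρ
    ; Z-invariant = Z-invariant
    ; O-invariant = λ π≗ρ → cong₂ _∧_ (holds-invariant G₁ π≗ρ) (O-invariant π≗ρ)
    ; Z⇒G≡0 = λ ρ ρ∈Z → proj₁ (∨-≡-false _ (Z⇒G≡0 ρ ρ∈Z))
    ; O⇒G≡1 = λ ρ ρ∈O → proj₁ (∧-≡-true _ ρ∈O)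
    ; T-pins = λ ω ω∈T′ → let (ω∈S , Zζ , Oη) = T-pins ω (proj₂ (∧-≡-true _ ω∈T′)) in
        ω∈S , Zζ , cong₂ _∧_ (proj₁ (∧-≡-true _ ω∈T′)) Oη
    }
    where open Rectangle r

  or-right : ∀ {G₁ G₂} → Rectangle (or G₁ G₂) → Rectangle G₂
  or-right {G₁} r = record
    { T = λ ω → not (holds G₁ (pin ω true)) ∧ T ω
    ; Z = Z
    ; O = λ ρ → not (holds G₁ ρ) ∧ O ρ
    ; Z-invariant = Z-invariant
    ; O-invariant = λ π≗ρ → cong₂ (λ a b → not a ∧ b) (holds-invariant G₁ π≗ρ) (O-invariant π≗ρ)
    ; Z⇒G≡0 = λ ρ ρ∈Z → proj₂ (∨-≡-false (holds G₁ ρ) (Z⇒G≡0 ρ ρ∈Z))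
    ; O⇒G≡1 = λ ρ ρ∈O → let (G₁≡0 , ρ∈O′) = ∧-≡-true _ ρ∈O in
        ∨-≡-true (not-≡-true G₁≡0) (O⇒G≡1 ρ ρ∈O′)
    ; T-pins = λ ω ω∈T′ → let (ω∈S , Zζ , Oη) = T-pins ω (proj₂ (∧-≡-true _ ω∈T′)) in
        ω∈S , Zζ , cong₂ _∧_ (proj₁ (∧-≡-true _ ω∈T′)) Oη
    }
    where open Rectangle r

  cover : ∀ G (r : Rectangle G) → Cover (leaves G) (Pr p (Rectangle.T r)) (μ (Rectangle.Z r) * μ (Rectangle.O r))
  cover (leaf ℓ₀) r = record
    { shares  = Pr p T ∷ []
    ; length≡ = refl
    ; ∑≡      = CR.+-identityʳ (Pr p T)
    ; ∑²≤     = begin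
        Pr p T * Pr p T + 0#    ≡⟨ CR.+-identityʳ _ ⟩
        Pr p T * Pr p T         ≤⟨ *-mono-≤-nonNeg (Pr-nonNeg T) T≤x+y (Pr-nonNeg T) T≤x+y ⟩
        (x + y) * (x + y)       ≤⟨ [x+y]²≤4w (Pr-Straddles² i true Z-invariant O-invariant)
                                             (Pr-Straddles² i false Z-invariant O-invariant) ⟩
        fromℕ R 4 * (q₀ * q₁ * (μ Z * μ O)) ∎
    }
    where
    open Rectangle r
    i = var ℓ₀
    x = Pr p (Straddles i true Z O)
    y = Pr p (Straddles i false Z O)
    T≤x+y : Pr p T ≤ x + y
    T≤x+y = Pr-⊆-∪ (λ ω ω∈T → Σ-Bool⇒⊎ (leaf-straddles ℓ₀ r ω ω∈T))
  cover (and G₁ G₂) r = subst₂ (Cover (leaves G₁ ℕ.+ leaves G₂)) T-split w-split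
    (cover-++ (cover G₁ (and-left r)) (cover G₂ (and-right r)))
    where
    open Rectangle r
    C : Event
    C ω = holds G₁ (pin ω false)
    T-split : Pr p (∁ C ∩ T) + Pr p (C ∩ T) ≡ Pr p T
    T-split = trans (CR.+-comm _ _) (sym (Pr-split C T))
    w-split : μ (λ ρ → not (holds G₁ ρ) ∧ Z ρ) * μ O + μ (λ ρ → holds G₁ ρ ∧ Z ρ) * μ O ≡ μ Z * μ O
    w-split = trans (sym (CR.distribʳ (μ O) _ _))
      (cong (_* μ O) (trans (CR.+-comm _ _) (sym (Pr-split (holds G₁ ∘ proj) (Z ∘ proj)))))
  cover (or G₁ G₂) r = subst₂ (Cover (leaves G₁ ℕ.+ leaves G₂)) T-split w-split
    (cover-++ (cover G₁ (or-left r)) (cover G₂ (or-right r)))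
    where
    open Rectangle r
    D : Event
    D ω = holds G₁ (pin ω true)
    T-split : Pr p (D ∩ T) + Pr p (∁ D ∩ T) ≡ Pr p T
    T-split = sym (Pr-split D T)
    w-split : μ Z * μ (λ ρ → holds G₁ ρ ∧ O ρ) + μ Z * μ (λ ρ → not (holds G₁ ρ) ∧ O ρ) ≡ μ Z * μ O
    w-split = trans (sym (CR.distribˡ (μ Z) _ _)) (cong (μ Z *_) (sym (Pr-split (holds G₁ ∘ proj) (O ∘ proj))))

  F-rectangle : Rectangle F
  F-rectangle = record
    { T = S ; Z = not ∘ holds F ; O = holds F
    ; Z-invariant = cong not ∘ holds-invariant F
    ; O-invariant = holds-invariant F
    ; Z⇒G≡0 = λ _ → not-≡-true
    ; O⇒G≡1 = λ _ ρ∈O → ρ∈O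
    ; T-pins = λ ω ω∈S → ω∈S , cong not (pinWith-value ω refl ω∈S false) , pinWith-value ω refl ω∈S true
    }

  4μ[F≡0]μ[F≡1]≤1 : fromℕ R 4 * (μ (not ∘ holds F) * μ (holds F)) ≤ 1#
  4μ[F≡0]μ[F≡1]≤1 = begin
    fromℕ R 4 * (μ Z * μ O)   ≤⟨ 4xy≤[x+y]² (μ Z) (μ O) ⟩
    (μ Z + μ O) * (μ Z + μ O) ≡⟨ cong (λ t → t * t) (trans (CR.+-comm (μ Z) (μ O)) μO+μZ≡1) ⟩
    1# * 1#                   ≡⟨ CR.*-identityʳ 1# ⟩
    1#                        ∎
    where
    Z O : Projection n m → Bool
    Z = not ∘ holds F
    O = holds F
    μO+μZ≡1 : μ O + μ Z ≡ 1#
    μO+μZ≡1 = trans (cong₂ _+_ (Pr-cong (λ _ → sym (∧-identityʳ _))) (Pr-cong (λ _ → sym (∧-identityʳ _))))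
                (trans (sym (Pr-split (O ∘ proj) (λ _ → true))) weight-sum)

  Pr[S]²≤q₀q₁L : Pr p S * Pr p S ≤ q₀ * q₁ * fromℕ R (leaves F)
  Pr[S]²≤q₀q₁L = begin
    Pr p S * Pr p S                                ≡⟨ cong₂ _*_ (sym ∑≡) (sym ∑≡) ⟩
    ∑ shares * ∑ shares                            ≤⟨ Cauchy–Schwarz shares ⟩
    fromℕ R (length shares) * ∑² shares            ≡⟨ cong (λ k → fromℕ R k * ∑² shares) length≡ ⟩
    L * ∑² shares                                  ≤⟨ *-monoˡ-≤-nonNeg L (fromℕ-nonNeg (leaves F)) ∑²≤ ⟩
    L * (fromℕ R 4 * (q₀ * q₁ * w))                ≡⟨ solve 4 (λ l f c w → l :* (f :* (c :* w))
                                                                   := c :* l :* (f :* w)) refl L (fromℕ R 4) (q₀ * q₁) w ⟩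
    q₀ * q₁ * L * (fromℕ R 4 * w)                  ≤⟨ *-monoˡ-≤-nonNeg _ 0≤q₀q₁L 4μ[F≡0]μ[F≡1]≤1 ⟩
    q₀ * q₁ * L * 1#                               ≡⟨ CR.*-identityʳ _ ⟩
    q₀ * q₁ * L                                    ∎
    where
    open Cover (cover F F-rectangle)
    L = fromℕ R (leaves F)
    w = μ (not ∘ holds F) * μ (holds F)
    x₀ = firstVariable F
    0≤q₀q₁L : 0# ≤ q₀ * q₁ * L
    0≤q₀q₁L = *-nonneg (*-nonneg (q-nonNeg x₀ false) (q-nonNeg x₀ true)) (fromℕ-nonNeg (leaves F))

lemma3p8 : (R : OrderedCommRing) → let open OrderedCommRing R in
    ∀ {n m : ℕ} (f : BoolFun n) (p : RandomProjection R n m) (q₀ q₁ : Carrier) →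
    Fixing p q₀ q₁ →
    ∀ (k : ℕ) → HasL f k →
    ∀ (S : Fin (RandomProjection.N p) → Bool) →
    (∀ ω → S ω ≡ true → HasL (restrict f (RandomProjection.proj p ω)) 1) →
    Pr p S * Pr p S ≤ (q₀ * q₁) * fromℕ R k
lemma3p8 R f p q₀ q₁ fixing k (inj₂ (_ , (F , F-computes , refl) , _)) S S⇒L1 =
  OneLeafRestrictions.Pr[S]²≤q₀q₁L f p q₀ q₁ fixing S S⇒L1 F F-computes
lemma3p8 R f p q₀ q₁ fixing .0 (inj₁ (f-constant , refl)) S S⇒L1 =
  ≤-reflexive (trans (cong₂ _*_ Pr[S]≡0 Pr[S]≡0) (trans (CR.zeroˡ 0#) (sym (CR.zeroʳ (q₀ * q₁)))))
  where
  open OrderedCommRing R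
  open OrderedCommRingProperties R
  Pr[S]≡0 : Pr p S ≡ 0#
  Pr[S]≡0 = Probability.Constant⇒Pr≡0 p f-constant S S⇒L1
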